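{- Let $\Omega$ be the shift orbit closure of a Sturmian word with characteristic word $\tilde\omega$, and let $\omega,\omega'\in\Omega$ be distinct with $T^{n_0}(\omega)=T^{n_0}(\omega')=\tilde\omega$ for some $n_0\ge1$. Then for every factor $u$ of the words in $\Omega$ and every non-principal ultrafilter $p\in\beta\mathbb N$, we have $\omega\big|_u\in p$ if and only if $\omega'\big|_u\in p$. In particular $p^*(\omega)=p^*(\omega')$.
   Context: A Sturmian word is an infinite binary word with exactly $n+1$ distinct factors of length $n$ for every $n\ge0$; $T$ is the shift; the characteristic word $\tilde\omega$ is the unique element of $\Omega$ all of whose prefixes are left special factors. $\omega\big|_u=\{n\in\mathbb N:\omega_n\cdots\omega_{n+|u|-1}=u\}$. $\beta\mathbb N$ is the set of ultrafilters on $\mathbb N=\{0,1,\dots\}$. For $p\in\beta\mathbb N$, $p^*(\omega)$ is the unique infinite word such that a finite word $u$ is a prefix of $p^*(\omega)$ iff $\omega\big|_u\in p$. -}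

module Defs where

open import Data.Nat using (ℕ; zero; suc; _+_)
open import Data.Bool using (Bool; true; false)
open import Data.List using (List; []; _∷_; length)
open import Data.List.Membership.Propositional using (_∈_)
open import Data.List.Relation.Unary.Unique.Propositional using (Unique)
open import Data.Product using (Σ; ∃; _×_; _,_)
open import Data.Sum using (_⊎_)
open import Data.Empty using (⊥)
open import Relation.Nullary using (¬_)
open import Relation.Binary.PropositionalEquality using (_≡_)
open import Function.Bundles using (_⇔_)

Word : Set
Word = ℕ → Bool

slice : Word → ℕ → ℕ → List Bool
slice w k zero    = []
slice w k (suc n) = w k ∷ slice w (suc k) n

Factor : List Bool → Word → Set
Factor u w = ∃ λ k → slice w k (length u) ≡ u

FactorCount : Word → ℕ → ℕ → Set
FactorCount w n m =
  Σ (List (List Bool)) λ L →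
    Unique L × length L ≡ m ×
    (∀ u → (u ∈ L) ⇔ (length u ≡ n × Factor u w))

Sturmian : Word → Set
Sturmian w = ∀ n → FactorCount w n (suc n)

-- Ω = shift orbit closure of x: words all of whose prefixes are factors of x
InOrbitClosure : Word → Word → Set
InOrbitClosure x y = ∀ n → Factor (slice y 0 n) x

-- left special factor of the language of Ω (= language of x)
LeftSpecial : Word → List Bool → Set
LeftSpecial x u = Factor (false ∷ u) x × Factor (true ∷ u) x

Characteristic : Word → Word → Set
Characteristic x c = InOrbitClosure x c × (∀ n → LeftSpecial x (slice c 0 n))

shift : ℕ → Word → Word
shift k w i = w (k + i)

occ : Word → List Bool → ℕ → Set
occ w u n = slice w n (length u) ≡ u

record IsUltrafilter (p : (ℕ → Set) → Set) : Set₁ where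
  field
    full    : p (λ _ → ℕ)
    noEmpty : ¬ p (λ _ → ⊥)
    upward  : ∀ A B → (∀ n → A n → B n) → p A → p B
    meet    : ∀ A B → p A → p B → p (λ n → A n × B n)
    ultra   : ∀ A → p A ⊎ p (λ n → ¬ A n)

NonPrincipal : ((ℕ → Set) → Set) → Set
NonPrincipal p = ∀ k → ¬ p (λ n → n ≡ k)

IsPStar : ((ℕ → Set) → Set) → Word → Word → Set
IsPStar p w z = ∀ u → (slice z 0 (length u) ≡ u) ⇔ p (occ w u)

-- Past position n₀ both words coincide with the characteristic word, so ω and ω' agree on a
-- cofinite set of positions, and hence ω|_u and ω'|_u agree on a cofinite set of indices.
-- A non-principal ultrafilter contains every cofinite set, so it cannot tell two sets apart
-- that differ only finitely.
module Submission where

open import Defs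
open import Data.Nat using (ℕ; zero; suc; _∸_; _≤_; _<_; _≥_)
open import Data.Nat.Properties using (≰⇒>; ≤∧≢⇒<; ≤-pred; m≤n⇒m≤1+n; m+[n∸m]≡n)
open import Data.List using (List; _∷_; length)
open import Data.Bool using (Bool)
open import Data.Product using (_×_; _,_)
open import Data.Sum using (inj₁; inj₂)
open import Relation.Nullary using (¬_; contradiction)
open import Relation.Binary.PropositionalEquality using (_≡_; refl; sym; trans; cong₂; subst)
open import Function.Bundles using (_⇔_; mk⇔)
import Function.Properties.Equivalence as ⇔

module _ {p : (ℕ → Set) → Set} (U : IsUltrafilter p) (nonPrincipal : NonPrincipal p) where
  open IsUltrafilter U

  initialSegment∉ : ∀ k → ¬ p (λ n → n < k)
  initialSegment∉ zero      n<0∈p = noEmpty (upward _ _ (λ _ ()) n<0∈p)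
  initialSegment∉ (suc k) n<1+k∈p with ultra (λ n → n ≡ k)
  ... | inj₁ ≡k∈p = nonPrincipal k ≡k∈p
  ... | inj₂ ≢k∈p = initialSegment∉ k
        (upward _ _ (λ _ (n<1+k , n≢k) → ≤∧≢⇒< (≤-pred n<1+k) n≢k) (meet _ _ n<1+k∈p ≢k∈p))

  tail∈ : ∀ k → p (λ n → k ≤ n)
  tail∈ k with ultra (λ n → k ≤ n)
  ... | inj₁ tail∈p = tail∈p
  ... | inj₂ ≰∈p    = contradiction (upward _ _ (λ _ → ≰⇒>) ≰∈p) (initialSegment∉ k)

  upward-eventually : ∀ k {A B : ℕ → Set} → (∀ n → k ≤ n → A n → B n) → p A → p B
  upward-eventually k A⇒B A∈p =
    upward _ _ (λ n (a , k≤n) → A⇒B n k≤n a) (meet _ _ A∈p (tail∈ k))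

AgreeFrom : ℕ → Word → Word → Set
AgreeFrom k w w' = ∀ i → k ≤ i → w i ≡ w' i

AgreeFrom-sym : ∀ {k w w'} → AgreeFrom k w w' → AgreeFrom k w' w
AgreeFrom-sym agree i k≤i = sym (agree i k≤i)

AgreeFrom-shift : ∀ k {w w' c : Word} →
                  (∀ i → shift k w i ≡ c i) → (∀ i → shift k w' i ≡ c i) → AgreeFrom k w w'
AgreeFrom-shift k {w} {w'} w≈c w'≈c i k≤i =
  subst (λ j → w j ≡ w' j) (m+[n∸m]≡n k≤i) (trans (w≈c (i ∸ k)) (sym (w'≈c (i ∸ k))))

slice-AgreeFrom : ∀ {k w w'} → AgreeFrom k w w' → ∀ n m → k ≤ n → slice w n m ≡ slice w' n m
slice-AgreeFrom agree n zero    k≤n = refl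
slice-AgreeFrom agree n (suc m) k≤n =
  cong₂ _∷_ (agree n k≤n) (slice-AgreeFrom agree (suc n) m (m≤n⇒m≤1+n k≤n))

occ∈-AgreeFrom : ∀ {p} → IsUltrafilter p → NonPrincipal p →
                 ∀ {k w w'} → AgreeFrom k w w' → ∀ u → p (occ w u) ⇔ p (occ w' u)
occ∈-AgreeFrom {p} U nonPrincipal agree u = mk⇔ (transport agree) (transport (AgreeFrom-sym agree))
  where
  transport : ∀ {k w w'} → AgreeFrom k w w' → p (occ w u) → p (occ w' u)
  transport {k} agree = upward-eventually U nonPrincipal k
    (λ n k≤n w|u → trans (sym (slice-AgreeFrom agree n (length u) k≤n)) w|u)

IsPStar-cong : ∀ p {w w'} → (∀ u → p (occ w u) ⇔ p (occ w' u)) →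
               ∀ z → IsPStar p w z ⇔ IsPStar p w' z
IsPStar-cong p occ⇔ z =
  mk⇔ (λ w* u → ⇔.trans (w* u) (occ⇔ u)) (λ w'* u → ⇔.trans (w'* u) (⇔.sym (occ⇔ u)))

lemma5p5 : (x c ω ω' : Word) → Sturmian x → Characteristic x c
    → InOrbitClosure x ω → InOrbitClosure x ω'
    → ¬ (∀ i → ω i ≡ ω' i)
    → (n₀ : ℕ) → n₀ ≥ 1
    → (∀ i → shift n₀ ω i ≡ c i) → (∀ i → shift n₀ ω' i ≡ c i)
    → (p : (ℕ → Set) → Set) → IsUltrafilter p → NonPrincipal p
    → ((u : List Bool) → Factor u x → p (occ ω u) ⇔ p (occ ω' u))
      × ((z : Word) → IsPStar p ω z ⇔ IsPStar p ω' z)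
lemma5p5 x c ω ω' _ _ _ _ _ n₀ _ ω≈c ω'≈c p U nonPrincipal =
  (λ u _ → occ⇔ u) , IsPStar-cong p occ⇔
  where
  occ⇔ : ∀ u → p (occ ω u) ⇔ p (occ ω' u)
  occ⇔ = occ∈-AgreeFrom U nonPrincipal (AgreeFrom-shift n₀ ω≈c ω'≈c)
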